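{- Let $k \geq 2$ be an integer and let $p_1, \ldots, p_{k-1}$ be pairwise distinct prime numbers. Then there exists a partition $A_1, \ldots, A_k$ of $\mathbb{N}$ such that, for each $i = 1, \ldots, k-1$, none of the sets $A_1, \ldots, A_k$ is dense in $\mathbb{Z}_{p_i}$.
   Context: $\mathbb{N}$ denotes the set of positive integers, viewed as a subset of $\mathbb{Z}_p$ with the $p$-adic topology. -}

module Defs where

open import Data.Nat using (ℕ; _+_; _*_; _^_; _<_; _≤_)
open import Data.Product using (Σ; _×_; ∃)
open import Relation.Binary.PropositionalEquality using (_≡_)

Subset : Set₁
Subset = ℕ → Set

-- A ⊆ ℕ is dense in ℤ_p (p-adic topology): A meets every basic open
-- ball r + p^m ℤ_p (0 ≤ r < p^m), i.e. every residue class mod p^m.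
DenseInℤ : (p : ℕ) → Subset → Set
DenseInℤ p A =
  ∀ (m r : ℕ) → r < p ^ m → ∃ λ a → A a × ∃ λ q → a ≡ r + q * p ^ m

{-# OPTIONS --safe #-}
-- Give each n ≥ 1 a colour j ∈ {0, …, k−1} that differs from every residue n mod pᵢᵏ;
-- since there are only k − 1 residues, such a colour always exists (pigeonhole), and
-- n = j + 1 can be given colour j. The class of colour j then misses the residue class
-- j + pᵢᵏℤ_{pᵢ}, an open ball of ℤ_{pᵢ}, so it is not dense.
module Submission where

open import Defs
open import Data.Nat using (ℕ; _∸_; _≤_)
open import Data.Nat.Primality using (Prime)
open import Data.Fin using (Fin)
open import Data.Product using (Σ; _×_; ∃)
open import Relation.Nullary using (¬_)
open import Relation.Binary.PropositionalEquality using (_≡_)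
open import Function.Definitions using (Injective)

open import Data.Nat using (zero; suc; _+_; _*_; _^_; _<_; NonZero; NonTrivial; >-nonZero; nonTrivial⇒nonZero; nonTrivial⇒n>1; z≤n; s≤s; _<?_; _≟_)
open import Data.Nat.Properties using (m<m*n; m^n≢0; *-comm; ≤-<-trans; <-trans; <⇒≢; n<1+n; module ≤-Reasoning)
open import Data.Nat.DivMod using (_%_; [m+kn]%n≡m%n; m<n⇒m%n≡m)
open import Data.Nat.Primality using (prime⇒nonTrivial)
open import Data.Fin using (toℕ; fromℕ<)
open import Data.Fin.Properties using (any?; pigeonhole; ¬∀⟶∃¬; toℕ-injective; toℕ<n; toℕ-fromℕ<; fromℕ<-toℕ)
import Data.Fin.Properties as Fin
open import Data.Product using (_,_; proj₁; proj₂; map₂)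
open import Data.Empty using (⊥-elim)
open import Function using (_∘_)
open import Relation.Nullary using (yes; no)
open import Relation.Nullary.Negation using (¬∃⟶∀¬)
open import Relation.Binary.PropositionalEquality using (_≢_; refl; sym; cong; subst; module ≡-Reasoning)

n<m^n : ∀ m n .{{_ : NonTrivial m}} → n < m ^ n
n<m^n m zero = s≤s z≤n
n<m^n m (suc n) = begin-strict
  suc n      ≤⟨ n<m^n m n ⟩
  m ^ n      <⟨ m<m*n (m ^ n) m (nonTrivial⇒n>1 m) ⟩
  m ^ n * m  ≡⟨ *-comm (m ^ n) m ⟩
  m * m ^ n  ∎
  where
  open ≤-Reasoning
  instance
    m^n-nonZero : NonZero (m ^ n)
    m^n-nonZero = m^n≢0 m n {{nonTrivial⇒nonZero m}}

∃-∉-image-toℕ : ∀ {m n} → n < m → (g : Fin n → ℕ) → ∃ λ (j : Fin m) → ∀ i → g i ≢ toℕ j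
∃-∉-image-toℕ {m} n<m g =
  map₂ ¬∃⟶∀¬ (¬∀⟶∃¬ m _ (λ j → any? (λ i → g i ≟ toℕ j)) ¬every-value-hit)
  where
  ¬every-value-hit : ¬ (∀ j → ∃ λ i → g i ≡ toℕ j)
  ¬every-value-hit hit with pigeonhole n<m (proj₁ ∘ hit)
  ... | j₁ , j₂ , j₁<j₂ , same-preimage = Fin.<⇒≢ j₁<j₂ (toℕ-injective (begin
    toℕ j₁                ≡⟨ sym (proj₂ (hit j₁)) ⟩
    g (proj₁ (hit j₁))    ≡⟨ cong g same-preimage ⟩
    g (proj₁ (hit j₂))    ≡⟨ proj₂ (hit j₂) ⟩
    toℕ j₂                ∎))
    where open ≡-Reasoning

¬dense-if-residue-missed : ∀ p m r (A : Subset) .{{_ : NonZero (p ^ m)}} → r < p ^ m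
  → (∀ a → A a → a % p ^ m ≢ r) → ¬ DenseInℤ p A
¬dense-if-residue-missed p m r A r<p^m misses dense with dense m r r<p^m
... | a , a∈A , q , refl = misses a a∈A (begin
  (r + q * p ^ m) % p ^ m  ≡⟨ [m+kn]%n≡m%n r q (p ^ m) ⟩
  r % p ^ m                ≡⟨ m<n⇒m%n≡m r<p^m ⟩
  r                        ∎)
  where open ≡-Reasoning

module ResidueAvoidingColouring (n : ℕ) (M : Fin n → ℕ) (1+n<M : ∀ i → suc n < M i) where

  instance
    M-nonZero : ∀ {i} → NonZero (M i)
    M-nonZero {i} = >-nonZero (≤-<-trans z≤n (1+n<M i))

  Avoids : ℕ → Fin (suc n) → Set
  Avoids x j = ∀ i → x % M i ≢ toℕ j

  avoidingColour : ∀ x → Σ (Fin (suc n)) (Avoids x)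
  avoidingColour x = ∃-∉-image-toℕ (n<1+n n) (λ i → x % M i)

  colour : ℕ → Fin (suc n)
  colour zero = proj₁ (avoidingColour zero)
  colour (suc x) with x <? suc n
  ... | yes x<1+n = fromℕ< x<1+n
  ... | no _ = proj₁ (avoidingColour (suc x))

  colour-avoids : ∀ x → Avoids x (colour x)
  colour-avoids zero = proj₂ (avoidingColour zero)
  colour-avoids (suc x) with x <? suc n
  ... | no _ = proj₂ (avoidingColour (suc x))
  ... | yes x<1+n = λ i 1+x≡x → <⇒≢ (n<1+n x) (sym (begin
    suc x                    ≡⟨ m<n⇒m%n≡m (≤-<-trans x<1+n (1+n<M i)) ⟨
    suc x % M i              ≡⟨ 1+x≡x ⟩
    toℕ (fromℕ< x<1+n)       ≡⟨ toℕ-fromℕ< x<1+n ⟩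
    x                        ∎))
    where open ≡-Reasoning

  colour-suc-toℕ : ∀ j → colour (suc (toℕ j)) ≡ j
  colour-suc-toℕ j with toℕ j <? suc n
  ... | yes j<1+n = fromℕ<-toℕ j j<1+n
  ... | no j≮1+n = ⊥-elim (j≮1+n (toℕ<n j))

theorem2p2 : (k : ℕ) → 2 ≤ k → (p : Fin (k ∸ 1) → ℕ) → (∀ i → Prime (p i))
    → Injective _≡_ _≡_ p
    → ∃ λ (c : ℕ → Fin k) →
        (∀ j → ∃ λ n → 1 ≤ n × c n ≡ j)
        × (∀ (i : Fin (k ∸ 1)) (j : Fin k) →
             ¬ DenseInℤ (p i) (λ n → 1 ≤ n × c n ≡ j))
theorem2p2 (suc n) _ p prime _ = colour , every-colour-used , classes-not-dense
  where
  instance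
    p-nonTrivial : ∀ {i} → NonTrivial (p i)
    p-nonTrivial {i} = prime⇒nonTrivial (prime i)

  open ResidueAvoidingColouring n (λ i → p i ^ suc n) (λ i → n<m^n (p i) (suc n))

  every-colour-used : ∀ j → ∃ λ x → 1 ≤ x × colour x ≡ j
  every-colour-used j = suc (toℕ j) , s≤s z≤n , colour-suc-toℕ j

  classes-not-dense : ∀ i j → ¬ DenseInℤ (p i) (λ x → 1 ≤ x × colour x ≡ j)
  classes-not-dense i j = ¬dense-if-residue-missed (p i) (suc n) (toℕ j) _
    (<-trans (toℕ<n j) (n<m^n (p i) (suc n)))
    (λ x (_ , colour-x≡j) → subst (Avoids x) colour-x≡j (colour-avoids x) i)
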